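{- Let $X$ and $S$ be nonnegative integers. The number of three-pile zero-nim positions having one (fixed) pile of size $X$ and two other piles of positive sizes summing to $S$ — i.e., the number of unordered pairs $\{a,b\}$ of positive integers with $a+b=S$ and $a\oplus b\oplus X=0$ — equals $f(S,X)$, where $$f(S,X)=\begin{cases} 0 & \text{if } S-X \text{ is odd},\\ 0 & \text{if } S-X \text{ is even and for some } i \text{ the } i\text{th binary digit of } \tfrac{S-X}{2} \text{ and of } X \text{ both equal } 1,\\ 2^{g(X)-1}-1 & \text{otherwise, if } S=X,\\ 2^{g(X)-1} & \text{otherwise (} S-X \text{ even).}\end{cases}$$ (The cases are checked in the order listed.)
   Context: $\oplus$ denotes bitwise exclusive-or. A zero-nim position is a position (tuple of pile sizes) whose nim-sum (bitwise XOR of the pile sizes) is $0$. For a nonnegative integer $n$, $g(n)$ denotes the number of $1$s in the binary expansion of $n$. Binary digits of a negative integer are taken in two's complement. -}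

module Defs where

open import Data.Nat using (ℕ; zero; suc; _+_; _*_; _∸_; _^_; _≤_; _≤?_; _≟_)
open import Data.Nat.DivMod using (_/_; _%_)
open import Data.Integer using (ℤ; +_; -[1+_])
open import Data.List using (List; length; filter; map; upTo; cartesianProduct)
open import Data.Nat.ListAction using (sum)
open import Data.Product using (_×_; _,_)
open import Relation.Binary.PropositionalEquality using (_≡_)
open import Relation.Nullary.Decidable using (Dec; _×-dec_)

bit : ℕ → ℕ → ℕ
bit n zero    = n % 2
bit n (suc i) = bit (n / 2) i

-- i-th binary digit of an integer, in two's complement:
-- -[1+ n] = -(n+1) is the bitwise complement of n
bitℤ : ℤ → ℕ → ℕ
bitℤ (+ n)    i = bit n i
bitℤ -[1+ n ] i = 1 ∸ bit n i

-- g(n): number of 1s in the binary expansion of n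
-- (digits at positions i ≥ n vanish since n < 2^i)
g : ℕ → ℕ
g n = sum (map (bit n) (upTo n))

-- bitwise exclusive-or
-- (digits at positions i ≥ a + b of a and b vanish)
_⊕_ : ℕ → ℕ → ℕ
a ⊕ b = sum (map (λ i → ((bit a i + bit b i) % 2) * 2 ^ i) (upTo (a + b)))

infixl 6 _⊕_

-- (a , b) represents the unordered pair {a, b} with a ≤ b, both positive,
-- a + b = S, and (X, a, b) a zero-nim position
IsPair : ℕ → ℕ → ℕ × ℕ → Set
IsPair S X (a , b) = (1 ≤ a) × (a ≤ b) × (a + b ≡ S) × (a ⊕ b ⊕ X ≡ 0)

isPair? : ∀ S X p → Dec (IsPair S X p)
isPair? S X (a , b) = (1 ≤? a) ×-dec (a ≤? b) ×-dec (a + b ≟ S) ×-dec (a ⊕ b ⊕ X ≟ 0)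

countPairs : ℕ → ℕ → ℕ
countPairs S X =
  length (filter (isPair? S X) (cartesianProduct (upTo (suc S)) (upTo (suc S))))

module Submission where

-- If a + b = S and a ⊕ b = X, then S = X + 2d where d, the bitwise AND of a and b, shares
-- no binary digit with X; conversely, for each such d the ordered solutions (a, b) correspond
-- to the 2^g(X) ways of distributing the digits of X between a and b. The ordered count is
-- established by strong induction on S, comparing the lowest binary digits of a, b, S and X.
-- For X ≠ 0 no solution has a = b, so exactly half of the ordered solutions have a < b, and
-- among those (0, S) is discarded precisely when S = X; for X = 0 the only pair is {S/2, S/2}.
-- A negative d is impossible: in two's complement every digit of X would be a digit of -1 - d,
-- so X ≤ -1 - d, while S - X = 2d makes X larger than that.

module FiniteSums where

  open import Data.Nat.Base
  open import Data.Nat.Properties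
  open import Data.Nat.ListAction using (sum)
  open import Data.Nat.ListAction.Properties using (sum-++)
  open import Data.List.Base using (List; []; _∷_; map; applyUpTo; upTo; filter; length; cartesianProduct; _++_)
  open import Data.List.Properties using (map-applyUpTo; map-++; map-∘)
  open import Data.Product using (_×_; _,_)
  open import Data.Sum using (_⊎_; inj₁; inj₂; [_,_])
  open import Function using (_∘_; id; flip)
  open import Function.Bundles using (_⇔_; Equivalence)
  open import Relation.Binary.PropositionalEquality using (_≡_; refl; sym; trans; cong; cong₂; module ≡-Reasoning)
  open import Relation.Nullary using (Dec; yes; no; ¬_; contradiction)
  open import Algebra.Properties.CommutativeSemigroup +-commutativeSemigroup using (interchange)
  open ≡-Reasoning

  ∑< : ℕ → (ℕ → ℕ) → ℕ
  ∑< zero    f = 0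
  ∑< (suc n) f = f 0 + ∑< n (f ∘ suc)

  sum-applyUpTo : ∀ f n → sum (applyUpTo f n) ≡ ∑< n f
  sum-applyUpTo f zero    = refl
  sum-applyUpTo f (suc n) = cong (f 0 +_) (sum-applyUpTo (f ∘ suc) n)

  sum-map-upTo : ∀ f n → sum (map f (upTo n)) ≡ ∑< n f
  sum-map-upTo f n = trans (cong sum (map-applyUpTo id f n)) (sum-applyUpTo f n)

  ∑<-cong : ∀ n {f h} → (∀ i → i < n → f i ≡ h i) → ∑< n f ≡ ∑< n h
  ∑<-cong zero    eq = refl
  ∑<-cong (suc n) eq = cong₂ _+_ (eq 0 z<s) (∑<-cong n (λ i i<n → eq (suc i) (s<s i<n)))

  ∑<-≡0 : ∀ n {f} → (∀ i → i < n → f i ≡ 0) → ∑< n f ≡ 0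
  ∑<-≡0 zero    eq = refl
  ∑<-≡0 (suc n) eq = cong₂ _+_ (eq 0 z<s) (∑<-≡0 n (λ i i<n → eq (suc i) (s<s i<n)))

  ∑<-mono-≤ : ∀ n {f h} → (∀ i → i < n → f i ≤ h i) → ∑< n f ≤ ∑< n h
  ∑<-mono-≤ zero    le = z≤n
  ∑<-mono-≤ (suc n) le = +-mono-≤ (le 0 z<s) (∑<-mono-≤ n (λ i i<n → le (suc i) (s<s i<n)))

  ∑<-+ : ∀ n f h → ∑< n (λ i → f i + h i) ≡ ∑< n f + ∑< n h
  ∑<-+ zero    f h = refl
  ∑<-+ (suc n) f h = begin
    f 0 + h 0 + ∑< n (λ i → f (suc i) + h (suc i))  ≡⟨ cong (f 0 + h 0 +_) (∑<-+ n (f ∘ suc) (h ∘ suc)) ⟩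
    f 0 + h 0 + (∑< n (f ∘ suc) + ∑< n (h ∘ suc))    ≡⟨ interchange (f 0) (h 0) _ _ ⟩
    f 0 + ∑< n (f ∘ suc) + (h 0 + ∑< n (h ∘ suc))    ∎

  ∑<-*ʳ : ∀ n f c → ∑< n (λ i → f i * c) ≡ ∑< n f * c
  ∑<-*ʳ zero    f c = refl
  ∑<-*ʳ (suc n) f c = begin
    f 0 * c + ∑< n (λ i → f (suc i) * c)  ≡⟨ cong (f 0 * c +_) (∑<-*ʳ n (f ∘ suc) c) ⟩
    f 0 * c + ∑< n (f ∘ suc) * c          ≡⟨ *-distribʳ-+ c (f 0) _ ⟨
    (f 0 + ∑< n (f ∘ suc)) * c            ∎

  ∑<-suc : ∀ n f → ∑< (suc n) f ≡ ∑< n f + f n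
  ∑<-suc zero    f = +-comm (f 0) 0
  ∑<-suc (suc n) f = trans (cong (f 0 +_) (∑<-suc n (f ∘ suc))) (sym (+-assoc (f 0) _ _))

  ∑<-even-odd : ∀ n f → ∑< (n * 2) f ≡ ∑< n (λ i → f (i * 2)) + ∑< n (λ i → f (1 + i * 2))
  ∑<-even-odd zero    f = refl
  ∑<-even-odd (suc n) f = begin
    f 0 + (f 1 + ∑< (n * 2) (f ∘ suc ∘ suc))  ≡⟨ cong (λ s → f 0 + (f 1 + s)) (∑<-even-odd n (f ∘ suc ∘ suc)) ⟩
    f 0 + (f 1 + (E + O))                     ≡⟨ +-assoc (f 0) (f 1) _ ⟨
    f 0 + f 1 + (E + O)                       ≡⟨ interchange (f 0) (f 1) E O ⟩
    f 0 + E + (f 1 + O)                       ∎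
    where
    E = ∑< n (λ i → f (2 + i * 2))
    O = ∑< n (λ i → f (3 + i * 2))

  ∑<-reverse : ∀ n f → ∑< n f ≡ ∑< n (λ i → f (n ∸ suc i))
  ∑<-reverse zero    f = refl
  ∑<-reverse (suc n) f = begin
    f 0 + ∑< n (f ∘ suc)                        ≡⟨ cong (f 0 +_) (∑<-reverse n (f ∘ suc)) ⟩
    f 0 + ∑< n (λ i → f (suc (n ∸ suc i)))      ≡⟨ +-comm (f 0) _ ⟩
    ∑< n (λ i → f (suc (n ∸ suc i))) + f 0      ≡⟨ cong₂ _+_ (∑<-cong n λ i i<n → cong f (+-∸-assoc 1 i<n)) (cong f (n∸n≡0 n)) ⟨
    ∑< n (λ i → f (n ∸ i)) + f (n ∸ n)           ≡⟨ ∑<-suc n (λ i → f (n ∸ i)) ⟨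
    ∑< (suc n) (λ i → f (n ∸ i))                 ∎

  ∑<-vanishing-tail : ∀ {n m f} → (∀ i → n ≤ i → f i ≡ 0) → n ≤ m → ∑< m f ≡ ∑< n f
  ∑<-vanishing-tail {n} {m} {f} tail n≤m with m≤n⇒∃[o]m+o≡n n≤m
  ... | k , refl = go k
    where
    go : ∀ k → ∑< (n + k) f ≡ ∑< n f
    go zero    = cong (λ m → ∑< m f) (+-identityʳ n)
    go (suc k) = begin
      ∑< (n + suc k) f        ≡⟨ cong (λ m → ∑< m f) (+-suc n k) ⟩
      ∑< (suc (n + k)) f      ≡⟨ ∑<-suc (n + k) f ⟩
      ∑< (n + k) f + f (n + k) ≡⟨ cong₂ _+_ (go k) (tail (n + k) (m≤m+n n k)) ⟩
      ∑< n f + 0              ≡⟨ +-identityʳ _ ⟩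
      ∑< n f                  ∎

  ∑<-truncation-invariant : ∀ {f} n m → (∀ i → n ≤ i → f i ≡ 0) → (∀ i → m ≤ i → f i ≡ 0) → ∑< n f ≡ ∑< m f
  ∑<-truncation-invariant n m tailₙ tailₘ with ≤-total n m
  ... | inj₁ n≤m = sym (∑<-vanishing-tail tailₙ n≤m)
  ... | inj₂ m≤n = ∑<-vanishing-tail tailₘ m≤n

  χ : ∀ {P : Set} → Dec P → ℕ
  χ (yes _) = 1
  χ (no _)  = 0

  χ-cong : ∀ {P Q : Set} (P? : Dec P) (Q? : Dec Q) → P ⇔ Q → χ P? ≡ χ Q?
  χ-cong (yes _) (yes _) P⇔Q = refl
  χ-cong (yes p) (no ¬q) P⇔Q = contradiction (Equivalence.to P⇔Q p) ¬q
  χ-cong (no ¬p) (yes q) P⇔Q = contradiction (Equivalence.from P⇔Q q) ¬p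
  χ-cong (no _)  (no _)  P⇔Q = refl

  χ-mono : ∀ {P Q : Set} (P? : Dec P) (Q? : Dec Q) → (P → Q) → χ P? ≤ χ Q?
  χ-mono (yes _) (yes _) f = ≤-refl
  χ-mono (yes p) (no ¬q) f = contradiction (f p) ¬q
  χ-mono (no _)  _       f = z≤n

  χ-yes : ∀ {P : Set} (P? : Dec P) → P → χ P? ≡ 1
  χ-yes (yes _) _ = refl
  χ-yes (no ¬p) p = contradiction p ¬p

  χ-no : ∀ {P : Set} (P? : Dec P) → ¬ P → χ P? ≡ 0
  χ-no (yes p) ¬p = contradiction p ¬p
  χ-no (no _)  _  = refl

  χ-⊎ : ∀ {P Q R : Set} (P? : Dec P) (Q? : Dec Q) (R? : Dec R) →
        (P → Q ⊎ R) → (Q → P) → (R → P) → (Q → ¬ R) → χ P? ≡ χ Q? + χ R?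
  χ-⊎ (yes _) (yes q) (yes r) split q⇒p r⇒p q⇒¬r = contradiction r (q⇒¬r q)
  χ-⊎ (yes _) (yes _) (no _)  split q⇒p r⇒p q⇒¬r = refl
  χ-⊎ (yes _) (no _)  (yes _) split q⇒p r⇒p q⇒¬r = refl
  χ-⊎ (yes p) (no ¬q) (no ¬r) split q⇒p r⇒p q⇒¬r = [ flip contradiction ¬q , flip contradiction ¬r ] (split p)
  χ-⊎ (no ¬p) (yes q) _       split q⇒p r⇒p q⇒¬r = contradiction (q⇒p q) ¬p
  χ-⊎ (no ¬p) (no _)  (yes r) split q⇒p r⇒p q⇒¬r = contradiction (r⇒p r) ¬p
  χ-⊎ (no _)  (no _)  (no _)  split q⇒p r⇒p q⇒¬r = refl

  count : ∀ {P : ℕ → Set} → (∀ a → Dec (P a)) → ℕ → ℕ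
  count P? n = ∑< n (χ ∘ P?)

  count-cong : ∀ {P Q : ℕ → Set} (P? : ∀ a → Dec (P a)) (Q? : ∀ a → Dec (Q a)) n →
               (∀ a → a < n → P a ⇔ Q a) → count P? n ≡ count Q? n
  count-cong P? Q? n P⇔Q = ∑<-cong n (λ a a<n → χ-cong (P? a) (Q? a) (P⇔Q a a<n))

  count-mono : ∀ {P Q : ℕ → Set} (P? : ∀ a → Dec (P a)) (Q? : ∀ a → Dec (Q a)) n →
               (∀ a → a < n → P a → Q a) → count P? n ≤ count Q? n
  count-mono P? Q? n f = ∑<-mono-≤ n (λ a a<n → χ-mono (P? a) (Q? a) (f a a<n))

  count-≡0 : ∀ {P : ℕ → Set} (P? : ∀ a → Dec (P a)) n → (∀ a → a < n → ¬ P a) → count P? n ≡ 0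
  count-≡0 P? n none = ∑<-≡0 n (λ a a<n → χ-no (P? a) (none a a<n))

  count-bounded : ∀ {P : ℕ → Set} (P? : ∀ a → Dec (P a)) {n m} → (∀ a → P a → a < n) → n ≤ m →
                  count P? m ≡ count P? n
  count-bounded P? bound = ∑<-vanishing-tail (λ a n≤a → χ-no (P? a) (λ p → <⇒≱ (bound a p) n≤a))

  count-unique : ∀ {P : ℕ → Set} (P? : ∀ a → Dec (P a)) {n c} {R : Set} (R? : Dec R) → c < n →
                 (∀ a → P a → a ≡ c) → P c ⇔ R → count P? n ≡ χ R?
  count-unique P? {suc n} {zero} R? _ unique Pc⇔R = begin
    χ (P? 0) + count (P? ∘ suc) n  ≡⟨ cong₂ _+_ (χ-cong (P? 0) R? Pc⇔R) (count-≡0 (P? ∘ suc) n λ a _ p → 1+n≢0 (unique (suc a) p)) ⟩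
    χ R? + 0                      ≡⟨ +-identityʳ _ ⟩
    χ R?                          ∎
  count-unique P? {suc n} {suc c} R? (s<s c<n) unique Pc⇔R =
    cong₂ _+_ (χ-no (P? 0) (λ p → 0≢1+n (unique 0 p)))
              (count-unique (P? ∘ suc) R? c<n (λ a p → suc-injective (unique (suc a) p)) Pc⇔R)

  length-filter : ∀ {A : Set} {P : A → Set} (P? : ∀ x → Dec (P x)) xs → length (filter P? xs) ≡ sum (map (χ ∘ P?) xs)
  length-filter P? []       = refl
  length-filter P? (x ∷ xs) with P? x
  ... | yes _ = cong suc (length-filter P? xs)
  ... | no _  = length-filter P? xs

  sum-map-cartesianProduct : ∀ {A B : Set} (h : A × B → ℕ) xs (ys : List B) →
    sum (map h (cartesianProduct xs ys)) ≡ sum (map (λ x → sum (map (λ y → h (x , y)) ys)) xs)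
  sum-map-cartesianProduct h []       ys = refl
  sum-map-cartesianProduct h (x ∷ xs) ys = begin
    sum (map h (map (x ,_) ys ++ cartesianProduct xs ys))          ≡⟨ cong sum (map-++ h (map (x ,_) ys) _) ⟩
    sum (map h (map (x ,_) ys) ++ map h (cartesianProduct xs ys))   ≡⟨ sum-++ (map h (map (x ,_) ys)) _ ⟩
    sum (map h (map (x ,_) ys)) + sum (map h (cartesianProduct xs ys))
      ≡⟨ cong₂ _+_ (cong sum (sym (map-∘ ys))) (sum-map-cartesianProduct h xs ys) ⟩
    sum (map (λ y → h (x , y)) ys) + sum (map (λ x → sum (map (λ y → h (x , y)) ys)) xs) ∎

module BinaryDigits where

  open import Defs
  open FiniteSums
  open import Data.Nat.Base
  open import Data.Nat.Properties
  open import Data.Nat.DivMod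
  open import Data.Nat.Induction using (<-rec)
  open import Data.Product using (_×_; _,_)
  open import Function using (_∘_)
  open import Relation.Binary.PropositionalEquality using (_≡_; _≢_; refl; sym; trans; cong; cong₂; subst; subst₂; module ≡-Reasoning)
  open import Data.Nat.Tactic.RingSolver using (solve-∀)

  data EvenOdd : ℕ → Set where
    even : ∀ k → EvenOdd (k * 2)
    odd  : ∀ k → EvenOdd (1 + k * 2)

  evenOdd : ∀ n → EvenOdd n
  evenOdd zero          = even 0
  evenOdd (suc zero)    = odd 0
  evenOdd (suc (suc n)) with evenOdd n
  ... | even k = even (suc k)
  ... | odd k  = odd (suc k)

  binary-rec : (P : ℕ → Set) → P 0 → (∀ k → P k → P (1 + k * 2)) → (∀ k → P (suc k) → P (suc k * 2)) →
               ∀ n → P n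
  binary-rec P base odd-step even-step = <-rec P step
    where
    step : ∀ n → (∀ {m} → m < n → P m) → P n
    step n rec with evenOdd n
    ... | odd k        = odd-step k (rec (s≤s (m≤m*n k 2)))
    ... | even zero    = base
    ... | even (suc k) = even-step k (rec (s<s (s≤s (m≤m*n k 2))))

  0<2 : 0 < 2
  0<2 = z<s

  1<2 : 1 < 2
  1<2 = s<s z<s

  bit-+*2-zero : ∀ {b} k → b < 2 → bit (b + k * 2) 0 ≡ b
  bit-+*2-zero {b} k b<2 = trans ([m+kn]%n≡m%n b k 2) (m<n⇒m%n≡m b<2)

  [b+k*2]/2≡k : ∀ {b} k → b < 2 → (b + k * 2) / 2 ≡ k
  [b+k*2]/2≡k {b} k b<2 = begin
    (b + k * 2) / 2     ≡⟨ +-distrib-/ b (k * 2) no-carry ⟩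
    b / 2 + k * 2 / 2   ≡⟨ cong₂ _+_ (m<n⇒m/n≡0 b<2) (m*n/n≡m k 2) ⟩
    k                   ∎
    where
    open ≡-Reasoning
    no-carry : b % 2 + k * 2 % 2 < 2
    no-carry = subst₂ (λ x y → x + y < 2) (sym (m<n⇒m%n≡m b<2)) (sym (m*n%n≡0 k 2)) (subst (_< 2) (sym (+-identityʳ b)) b<2)

  +*2-injective : ∀ {b c k l} → b < 2 → c < 2 → b + k * 2 ≡ c + l * 2 → b ≡ c × k ≡ l
  +*2-injective {b} {c} {k} {l} b<2 c<2 eq =
    trans (sym (bit-+*2-zero k b<2)) (trans (cong (_% 2) eq) (bit-+*2-zero l c<2)) ,
    trans (sym ([b+k*2]/2≡k k b<2)) (trans (cong (_/ 2) eq) ([b+k*2]/2≡k l c<2))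

  [k*2]%2≢[1+m*2]%2 : ∀ k m → (k * 2) % 2 ≢ (1 + m * 2) % 2
  [k*2]%2≢[1+m*2]%2 k m eq = 0≢1+n (trans (sym (bit-+*2-zero {0} k 0<2)) (trans eq (bit-+*2-zero m 1<2)))

  bit<2 : ∀ n i → bit n i < 2
  bit<2 n zero    = m%n<n n 2
  bit<2 n (suc i) = bit<2 (n / 2) i

  bit-+*2-suc : ∀ {b} k i → b < 2 → bit (b + k * 2) (suc i) ≡ bit k i
  bit-+*2-suc k i b<2 = cong (λ m → bit m i) ([b+k*2]/2≡k k b<2)

  bit-0 : ∀ i → bit 0 i ≡ 0
  bit-0 zero    = refl
  bit-0 (suc i) = bit-0 i

  bit-≥ : ∀ {n k} i → n < 2 ^ k → k ≤ i → bit n i ≡ 0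
  bit-≥ {n} i n<2^k k≤i = vanish i (<-≤-trans n<2^k (^-monoʳ-≤ 2 k≤i))
    where
    vanish : ∀ {n} i → n < 2 ^ i → bit n i ≡ 0
    vanish {zero}  zero    _          = refl
    vanish {suc _} zero    (s<s ())
    vanish {n}     (suc i) n<2^[1+i] = vanish i (m<n*o⇒m/o<n (subst (n <_) (*-comm 2 (2 ^ i)) n<2^[1+i]))

  n<2^n : ∀ n → n < 2 ^ n
  n<2^n zero    = z<s
  n<2^n (suc n) = begin-strict
    suc n           ≤⟨ n<2^n n ⟩
    2 ^ n           <⟨ m<m+n (2 ^ n) (m^n>0 2 n) ⟩
    2 ^ n + 2 ^ n   ≡⟨ cong (2 ^ n +_) (+-identityʳ (2 ^ n)) ⟨
    2 ^ suc n       ∎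
    where open ≤-Reasoning

  m≤n⇒m<2^n : ∀ {m n} → m ≤ n → m < 2 ^ n
  m≤n⇒m<2^n {m} m≤n = <-≤-trans (n<2^n m) (^-monoʳ-≤ 2 m≤n)

  xorDigit : ℕ → ℕ → ℕ → ℕ
  xorDigit a b i = ((bit a i + bit b i) % 2) * 2 ^ i

  ⊕-as-∑< : ∀ a b → a ⊕ b ≡ ∑< (a + b) (xorDigit a b)
  ⊕-as-∑< a b = sum-map-upTo (xorDigit a b) (a + b)

  ⊕-truncated : ∀ {a b} k → a < 2 ^ k → b < 2 ^ k → a ⊕ b ≡ ∑< k (xorDigit a b)
  ⊕-truncated {a} {b} k a<2^k b<2^k =
    trans (⊕-as-∑< a b) (∑<-truncation-invariant (a + b) k
      (vanish (a + b) (m≤n⇒m<2^n (m≤m+n a b)) (m≤n⇒m<2^n (m≤n+m b a))) (vanish k a<2^k b<2^k))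
    where
    vanish : ∀ k → a < 2 ^ k → b < 2 ^ k → ∀ i → k ≤ i → xorDigit a b i ≡ 0
    vanish k a< b< i k≤i rewrite bit-≥ i a< k≤i | bit-≥ i b< k≤i = refl

  +*2-< : ∀ {u a} k → u < 2 → a < 2 ^ k → u + a * 2 < 2 ^ suc k
  +*2-< {u} {a} k u<2 a<2^k = begin-strict
    u + a * 2      <⟨ +-monoˡ-< (a * 2) u<2 ⟩
    suc a * 2      ≤⟨ *-monoˡ-≤ 2 a<2^k ⟩
    2 ^ k * 2      ≡⟨ *-comm (2 ^ k) 2 ⟩
    2 ^ suc k      ∎
    where open ≤-Reasoning

  ⊕-step : ∀ {u v} a b → u < 2 → v < 2 → (u + a * 2) ⊕ (v + b * 2) ≡ (u + v) % 2 + (a ⊕ b) * 2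
  ⊕-step {u} {v} a b u<2 v<2 = begin
    A ⊕ B                                         ≡⟨ ⊕-truncated (suc K) (+*2-< K u<2 a<2^K) (+*2-< K v<2 b<2^K) ⟩
    xorDigit A B 0 + ∑< K (xorDigit A B ∘ suc)    ≡⟨ cong₂ _+_ lowest-digit (∑<-cong K λ i _ → higher-digit i) ⟩
    (u + v) % 2 + ∑< K (λ i → xorDigit a b i * 2) ≡⟨ cong ((u + v) % 2 +_) (∑<-*ʳ K (xorDigit a b) 2) ⟩
    (u + v) % 2 + ∑< K (xorDigit a b) * 2         ≡⟨ cong (λ x → (u + v) % 2 + x * 2) (⊕-truncated K a<2^K b<2^K) ⟨
    (u + v) % 2 + (a ⊕ b) * 2                     ∎
    where
    open ≡-Reasoning
    A = u + a * 2
    B = v + b * 2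
    K = a + b
    a<2^K : a < 2 ^ K
    a<2^K = m≤n⇒m<2^n (m≤m+n a b)
    b<2^K : b < 2 ^ K
    b<2^K = m≤n⇒m<2^n (m≤n+m b a)
    lowest-digit : xorDigit A B 0 ≡ (u + v) % 2
    lowest-digit rewrite bit-+*2-zero a u<2 | bit-+*2-zero b v<2 = *-identityʳ _
    higher-digit : ∀ i → xorDigit A B (suc i) ≡ xorDigit a b i * 2
    higher-digit i rewrite bit-+*2-suc a i u<2 | bit-+*2-suc b i v<2 = shift ((bit a i + bit b i) % 2) (2 ^ i)
      where
      shift : ∀ x y → x * (2 * y) ≡ x * y * 2
      shift = solve-∀

  ⊕-comm : ∀ a b → a ⊕ b ≡ b ⊕ a
  ⊕-comm a b = begin
    a ⊕ b                         ≡⟨ ⊕-as-∑< a b ⟩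
    ∑< (a + b) (xorDigit a b)     ≡⟨ ∑<-cong (a + b) (λ i _ → cong (λ x → x % 2 * 2 ^ i) (+-comm (bit a i) (bit b i))) ⟩
    ∑< (a + b) (xorDigit b a)     ≡⟨ cong (λ n → ∑< n (xorDigit b a)) (+-comm a b) ⟩
    ∑< (b + a) (xorDigit b a)     ≡⟨ ⊕-as-∑< b a ⟨
    b ⊕ a                         ∎
    where open ≡-Reasoning

  ⊕-self : ∀ a → a ⊕ a ≡ 0
  ⊕-self a = trans (⊕-as-∑< a a) (∑<-≡0 (a + a) λ i _ → cong (_* 2 ^ i) (x+x%2≡0 (bit a i)))
    where
    doubling : ∀ x → x + x ≡ x * 2
    doubling = solve-∀
    x+x%2≡0 : ∀ x → (x + x) % 2 ≡ 0
    x+x%2≡0 x = trans (cong (_% 2) (doubling x)) (m*n%n≡0 x 2)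

  ⊕-identityˡ : ∀ b → 0 ⊕ b ≡ b
  ⊕-identityˡ = binary-rec (λ b → 0 ⊕ b ≡ b) refl
    (λ k ih → trans (⊕-step {0} {1} 0 k 0<2 1<2) (cong (λ x → 1 + x * 2) ih))
    (λ k ih → trans (⊕-step {0} {0} 0 (suc k) 0<2 0<2) (cong (_* 2) ih))

  ⊕≡0⇒≡ : ∀ a b → a ⊕ b ≡ 0 → a ≡ b
  ⊕≡0⇒≡ = binary-rec (λ a → ∀ b → a ⊕ b ≡ 0 → a ≡ b) base odd-step even-step
    where
    base : ∀ b → 0 ⊕ b ≡ 0 → 0 ≡ b
    base b eq = trans (sym eq) (⊕-identityˡ b)
    odd-step : ∀ k → (∀ b → k ⊕ b ≡ 0 → k ≡ b) → ∀ b → (1 + k * 2) ⊕ b ≡ 0 → 1 + k * 2 ≡ b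
    odd-step k ih b eq with evenOdd b
    ... | even m with () ← trans (sym (⊕-step {1} {0} k m 1<2 0<2)) eq
    ... | odd m  = cong (λ x → 1 + x * 2) (ih m (m*n≡0⇒m≡0 (k ⊕ m) 2 (trans (sym (⊕-step {1} {1} k m 1<2 1<2)) eq)))
    even-step : ∀ k → (∀ b → suc k ⊕ b ≡ 0 → suc k ≡ b) → ∀ b → suc k * 2 ⊕ b ≡ 0 → suc k * 2 ≡ b
    even-step k ih b eq with evenOdd b
    ... | even m = cong (_* 2) (ih m (m*n≡0⇒m≡0 (suc k ⊕ m) 2 (trans (sym (⊕-step {0} {0} (suc k) m 0<2 0<2)) eq)))
    ... | odd m with () ← trans (sym (⊕-step {0} {1} (suc k) m 0<2 1<2)) eq

  g-truncated : ∀ {n} k → n < 2 ^ k → g n ≡ ∑< k (bit n)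
  g-truncated {n} k n<2^k =
    trans (sum-map-upTo (bit n) n) (∑<-truncation-invariant n k (λ i → bit-≥ i (n<2^n n)) (λ i → bit-≥ i n<2^k))

  g-step : ∀ {b} k → b < 2 → g (b + k * 2) ≡ b + g k
  g-step {b} k b<2 = begin
    g (b + k * 2)                                  ≡⟨ g-truncated (suc k) (+*2-< k b<2 (n<2^n k)) ⟩
    bit (b + k * 2) 0 + ∑< k (bit (b + k * 2) ∘ suc) ≡⟨ cong₂ _+_ (bit-+*2-zero k b<2) (∑<-cong k λ i _ → bit-+*2-suc k i b<2) ⟩
    b + ∑< k (bit k)                               ≡⟨ cong (b +_) (g-truncated k (n<2^n k)) ⟨
    b + g k                                        ∎
    where open ≡-Reasoning

  g-pos : ∀ n → 0 < n → 0 < g n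
  g-pos = binary-rec (λ n → 0 < n → 0 < g n) (λ ())
    (λ k _ _ → subst (0 <_) (sym (g-step {1} k 1<2)) z<s)
    (λ k ih _ → subst (0 <_) (sym (g-step {0} (suc k) 0<2)) (ih z<s))

  bits-⊆⇒≤ : ∀ m n → (∀ i → bit m i ≡ 1 → bit n i ≡ 1) → m ≤ n
  bits-⊆⇒≤ = binary-rec (λ m → ∀ n → (∀ i → bit m i ≡ 1 → bit n i ≡ 1) → m ≤ n) (λ _ _ → z≤n) odd-step even-step
    where
    shifted : ∀ {u v} k m → u < 2 → v < 2 → (∀ i → bit (u + k * 2) i ≡ 1 → bit (v + m * 2) i ≡ 1) →
              ∀ i → bit k i ≡ 1 → bit m i ≡ 1
    shifted k m u<2 v<2 ⊆ i bk =
      trans (sym (bit-+*2-suc m i v<2)) (⊆ (suc i) (trans (bit-+*2-suc k i u<2) bk))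
    odd-step : ∀ k → (∀ n → (∀ i → bit k i ≡ 1 → bit n i ≡ 1) → k ≤ n) →
               ∀ n → (∀ i → bit (1 + k * 2) i ≡ 1 → bit n i ≡ 1) → 1 + k * 2 ≤ n
    odd-step k ih n ⊆ with evenOdd n
    ... | even m with () ← trans (sym (bit-+*2-zero {0} m 0<2)) (⊆ 0 (bit-+*2-zero k 1<2))
    ... | odd m  = s≤s (*-monoˡ-≤ 2 (ih m (shifted k m 1<2 1<2 ⊆)))
    even-step : ∀ k → (∀ n → (∀ i → bit (suc k) i ≡ 1 → bit n i ≡ 1) → suc k ≤ n) →
                ∀ n → (∀ i → bit (suc k * 2) i ≡ 1 → bit n i ≡ 1) → suc k * 2 ≤ n
    even-step k ih n ⊆ with evenOdd n
    ... | even m = *-monoˡ-≤ 2 (ih m (shifted (suc k) m 0<2 0<2 ⊆))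
    ... | odd m  = m≤n⇒m≤1+n (*-monoˡ-≤ 2 (ih m (shifted (suc k) m 0<2 1<2 ⊆)))

module Splittings where

  open import Defs
  open FiniteSums
  open BinaryDigits
  open import Data.Nat.Base
  open import Data.Nat.Properties
  open import Data.Nat.DivMod
  open import Data.Nat.Induction using (<-rec)
  open import Data.Product using (∃; _×_; _,_; proj₁; proj₂)
  open import Data.Sum using (_⊎_; inj₁; inj₂)
  open import Function using (_∘_)
  open import Function.Bundles using (_⇔_; mk⇔; Equivalence)
  open import Relation.Binary.PropositionalEquality using (_≡_; _≢_; refl; sym; trans; cong; cong₂; subst; module ≡-Reasoning)
  open import Relation.Nullary using (Dec; ¬_; contradiction)
  open import Relation.Nullary.Decidable using (map′; _×-dec_)
  open import Data.Nat.Tactic.RingSolver using (solve-∀)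

  Splits : ℕ → ℕ → ℕ → Set
  Splits S X a = ∃ λ b → a + b ≡ S × a ⊕ b ≡ X

  splits⇔ : ∀ {S X a} → Splits S X a ⇔ (a ≤ S × a ⊕ (S ∸ a) ≡ X)
  splits⇔ {S} {X} {a} = mk⇔ to from
    where
    to : Splits S X a → a ≤ S × a ⊕ (S ∸ a) ≡ X
    to (b , refl , a⊕b≡X) = m≤m+n a b , subst (λ c → a ⊕ c ≡ X) (sym (m+n∸m≡n a b)) a⊕b≡X
    from : a ≤ S × a ⊕ (S ∸ a) ≡ X → Splits S X a
    from (a≤S , eq) = S ∸ a , m+[n∸m]≡n a≤S , eq

  splits? : ∀ S X a → Dec (Splits S X a)
  splits? S X a = map′ (Equivalence.from splits⇔) (Equivalence.to splits⇔) ((a ≤? S) ×-dec (a ⊕ (S ∸ a) ≟ X))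

  splits-≤ : ∀ {S X a} → Splits S X a → a ≤ S
  splits-≤ = proj₁ ∘ Equivalence.to splits⇔

  splitCount : ℕ → ℕ → ℕ
  splitCount S X = count (splits? S X) (suc S)

  ⊕-%2 : ∀ a b → (a ⊕ b) % 2 ≡ (a + b) % 2
  ⊕-%2 a b = begin
    (a ⊕ b) % 2                                     ≡⟨ cong₂ (λ x y → (x ⊕ y) % 2) (m≡m%n+[m/n]*n a 2) (m≡m%n+[m/n]*n b 2) ⟩
    ((a % 2 + a / 2 * 2) ⊕ (b % 2 + b / 2 * 2)) % 2 ≡⟨ cong (_% 2) (⊕-step (a / 2) (b / 2) (m%n<n a 2) (m%n<n b 2)) ⟩
    ((a % 2 + b % 2) % 2 + (a / 2 ⊕ b / 2) * 2) % 2 ≡⟨ [m+kn]%n≡m%n ((a % 2 + b % 2) % 2) (a / 2 ⊕ b / 2) 2 ⟩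
    (a % 2 + b % 2) % 2 % 2                         ≡⟨ m%n%n≡m%n (a % 2 + b % 2) 2 ⟩
    (a % 2 + b % 2) % 2                             ≡⟨ %-distribˡ-+ a b 2 ⟨
    (a + b) % 2                                     ∎
    where open ≡-Reasoning

  splits-parity : ∀ {S X a} → Splits S X a → S % 2 ≡ X % 2
  splits-parity {a = a} (b , refl , refl) = sym (⊕-%2 a b)

  splits-even⇔ : ∀ {σ S X a} → σ < 2 → Splits (σ + S * 2) (σ + X * 2) (a * 2) ⇔ Splits S X a
  splits-even⇔ {σ} {S} {X} {a} σ<2 = mk⇔ to from
    where
    to : Splits (σ + S * 2) (σ + X * 2) (a * 2) → Splits S X a
    to (b , sum≡ , xor≡) with evenOdd b
    ... | even b′ = b′ , proj₂ (+*2-injective 0<2 σ<2 (trans (*-distribʳ-+ 2 a b′) sum≡))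
                       , proj₂ (+*2-injective 0<2 σ<2 (trans (sym (⊕-step {0} {0} a b′ 0<2 0<2)) xor≡))
    ... | odd b′  = b′ , proj₂ (+*2-injective 1<2 σ<2 (trans (carry a b′) sum≡))
                       , proj₂ (+*2-injective 1<2 σ<2 (trans (sym (⊕-step {0} {1} a b′ 0<2 1<2)) xor≡))
      where
      carry : ∀ a b → 1 + (a + b) * 2 ≡ a * 2 + (1 + b * 2)
      carry = solve-∀
    from : Splits S X a → Splits (σ + S * 2) (σ + X * 2) (a * 2)
    from (b , refl , refl) =
      σ + b * 2 , digits σ a b , trans (⊕-step {0} {σ} a b 0<2 σ<2) (cong (_+ (a ⊕ b) * 2) (m<n⇒m%n≡m σ<2))
      where
      digits : ∀ σ a b → a * 2 + (σ + b * 2) ≡ σ + (a + b) * 2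
      digits = solve-∀

  splits-odd⇔ : ∀ {S X a} → Splits (1 + S * 2) (1 + X * 2) (1 + a * 2) ⇔ Splits S X a
  splits-odd⇔ {S} {X} {a} = mk⇔ to from
    where
    digits : ∀ a b → 1 + a * 2 + b * 2 ≡ 1 + (a + b) * 2
    digits = solve-∀
    to : Splits (1 + S * 2) (1 + X * 2) (1 + a * 2) → Splits S X a
    to (b , sum≡ , xor≡) with evenOdd b
    ... | even b′ = b′ , proj₂ (+*2-injective 1<2 1<2 (trans (sym (digits a b′)) sum≡))
                       , proj₂ (+*2-injective 1<2 1<2 (trans (sym (⊕-step {1} {0} a b′ 1<2 0<2)) xor≡))
    ... | odd b′ with () ← proj₁ (+*2-injective {k = a ⊕ b′} {l = X} 0<2 1<2 (trans (sym (⊕-step {1} {1} a b′ 1<2 1<2)) xor≡))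
    from : Splits S X a → Splits (1 + S * 2) (1 + X * 2) (1 + a * 2)
    from (b , refl , refl) = b * 2 , digits a b , ⊕-step {1} {0} a b 1<2 0<2

  splits-carry⇔ : ∀ {S X a} → Splits (suc S * 2) (X * 2) (1 + a * 2) ⇔ Splits S X a
  splits-carry⇔ {S} {X} {a} = mk⇔ to from
    where
    digits : ∀ a b → 1 + a * 2 + (1 + b * 2) ≡ suc (a + b) * 2
    digits = solve-∀
    to : Splits (suc S * 2) (X * 2) (1 + a * 2) → Splits S X a
    to (b , sum≡ , xor≡) with evenOdd b
    ... | even b′ with () ← proj₁ (+*2-injective {k = a ⊕ b′} {l = X} 1<2 0<2 (trans (sym (⊕-step {1} {0} a b′ 1<2 0<2)) xor≡))
    ... | odd b′  = b′ , suc-injective (proj₂ (+*2-injective 0<2 0<2 (trans (sym (digits a b′)) sum≡)))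
                       , proj₂ (+*2-injective 0<2 0<2 (trans (sym (⊕-step {1} {1} a b′ 1<2 1<2)) xor≡))
    from : Splits S X a → Splits (suc S * 2) (X * 2) (1 + a * 2)
    from (b , refl , refl) = 1 + b * 2 , digits a b , ⊕-step {1} {1} a b 1<2 1<2

  -- Phrased as in the theorem, so that for d = + n its hypothesis is literally Disjoint n X.
  Disjoint : ℕ → ℕ → Set
  Disjoint m n = ¬ ∃ λ i → bit m i ≡ 1 × bit n i ≡ 1

  disjoint-halve : ∀ {u v m n} → u < 2 → v < 2 → Disjoint (u + m * 2) (v + n * 2) → Disjoint m n
  disjoint-halve {m = m} {n} u<2 v<2 disjoint (i , bm , bn) =
    disjoint (suc i , trans (bit-+*2-suc m i u<2) bm , trans (bit-+*2-suc n i v<2) bn)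

  disjoint-double : ∀ {u v m n} → u < 2 → v < 2 → ¬ (u ≡ 1 × v ≡ 1) → Disjoint m n → Disjoint (u + m * 2) (v + n * 2)
  disjoint-double {m = m} {n} u<2 v<2 not-both disjoint (zero , bu , bv) =
    not-both (trans (sym (bit-+*2-zero m u<2)) bu , trans (sym (bit-+*2-zero n v<2)) bv)
  disjoint-double {m = m} {n} u<2 v<2 not-both disjoint (suc i , bu , bv) =
    disjoint (i , trans (sym (bit-+*2-suc m i u<2)) bu , trans (sym (bit-+*2-suc n i v<2)) bv)

  -- d is the bitwise AND of the two summands.
  Admissible : ℕ → ℕ → Set
  Admissible S X = ∃ λ d → S ≡ X + d * 2 × Disjoint d X

  admissible-parity : ∀ {S X} → Admissible S X → S % 2 ≡ X % 2
  admissible-parity {X = X} (d , refl , _) = [m+kn]%n≡m%n X d 2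

  admissible-zero⇔ : ∀ {X} → Admissible 0 X ⇔ X ≡ 0
  admissible-zero⇔ {X} = mk⇔ (λ (d , eq , _) → m+n≡0⇒m≡0 X (sym eq)) from
    where
    from : X ≡ 0 → Admissible 0 X
    from refl = 0 , refl , λ (i , b0 , _) → 0≢1+n (trans (sym (bit-0 i)) b0)

  admissible-suc-exclusive : ∀ {S X} → Admissible (suc S) X → ¬ Admissible S X
  admissible-suc-exclusive {X = X} (d , eq , _) (d′ , refl , _)
    with () ← proj₁ (+*2-injective {k = d′} {l = d} 1<2 0<2 (+-cancelˡ-≡ X (1 + d′ * 2) (d * 2) (trans (+-suc X (d′ * 2)) eq)))

  admissible-odd⇔ : ∀ {S X} → Admissible (1 + S * 2) (1 + X * 2) ⇔ Admissible S X
  admissible-odd⇔ {S} {X} = mk⇔ to from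
    where
    digits : ∀ X d → 1 + X * 2 + d * 2 * 2 ≡ 1 + (X + d * 2) * 2
    digits = solve-∀
    to : Admissible (1 + S * 2) (1 + X * 2) → Admissible S X
    to (d , eq , disjoint) with evenOdd d
    ... | even d′ = d′ , proj₂ (+*2-injective 1<2 1<2 (trans eq (digits X d′))) , disjoint-halve 0<2 1<2 disjoint
    ... | odd d′  = contradiction (0 , bit-+*2-zero d′ 1<2 , bit-+*2-zero X 1<2) disjoint
    from : Admissible S X → Admissible (1 + S * 2) (1 + X * 2)
    from (d , refl , disjoint) = d * 2 , sym (digits X d) , disjoint-double 0<2 1<2 (λ ()) disjoint

  admissible-even⇔ : ∀ {S X} → Admissible (suc S * 2) (X * 2) ⇔ (Admissible (suc S) X ⊎ Admissible S X)
  admissible-even⇔ {S} {X} = mk⇔ to from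
    where
    no-carry : ∀ X d → X * 2 + d * 2 * 2 ≡ (X + d * 2) * 2
    no-carry = solve-∀
    carry : ∀ X d → X * 2 + (1 + d * 2) * 2 ≡ suc (X + d * 2) * 2
    carry = solve-∀
    to : Admissible (suc S * 2) (X * 2) → Admissible (suc S) X ⊎ Admissible S X
    to (d , eq , disjoint) with evenOdd d
    ... | even d′ = inj₁ (d′ , *-cancelʳ-≡ (suc S) _ 2 (trans eq (no-carry X d′)) , disjoint-halve 0<2 0<2 disjoint)
    ... | odd d′  = inj₂ (d′ , suc-injective (*-cancelʳ-≡ (suc S) _ 2 (trans eq (carry X d′))) , disjoint-halve 1<2 0<2 disjoint)
    from : Admissible (suc S) X ⊎ Admissible S X → Admissible (suc S * 2) (X * 2)
    from (inj₁ (d , eq , disjoint)) =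
      d * 2 , trans (cong (_* 2) eq) (sym (no-carry X d)) , disjoint-double 0<2 0<2 (λ ()) disjoint
    from (inj₂ (d , eq , disjoint)) =
      1 + d * 2 , trans (cong (λ s → suc s * 2) eq) (sym (carry X d)) , disjoint-double 1<2 0<2 (λ ()) disjoint

  SplitCountSpec : ℕ → ℕ → Set
  SplitCountSpec S X = (Admissible S X → splitCount S X ≡ 2 ^ g X) × (¬ Admissible S X → splitCount S X ≡ 0)

  splitCount-even-odd : ∀ {σ} S X → σ < 2 →
    splitCount (σ + S * 2) X ≡ count (λ a → splits? (σ + S * 2) X (a * 2)) (suc S)
                             + count (λ a → splits? (σ + S * 2) X (1 + a * 2)) (suc S)
  splitCount-even-odd {σ} S X σ<2 =
    trans (sym (count-bounded (splits? _ X) (λ _ → s≤s ∘ splits-≤) (s≤s (+-monoˡ-≤ (S * 2) (≤-pred σ<2)))))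
          (∑<-even-odd (suc S) (χ ∘ splits? (σ + S * 2) X))

  splitCount-parity-mismatch : ∀ {S X} → S % 2 ≢ X % 2 → SplitCountSpec S X
  splitCount-parity-mismatch {S} {X} parities≢ = (λ adm → contradiction (admissible-parity adm) parities≢)
                                              , (λ _ → count-≡0 (splits? S X) (suc S) λ a _ sp → parities≢ (splits-parity sp))

  splits-0⇒X≡0 : ∀ {X a} → Splits 0 X a → X ≡ 0
  splits-0⇒X≡0 {a = zero}  (zero  , refl , refl) = refl
  splits-0⇒X≡0 {a = zero}  (suc _ , ()   , _)
  splits-0⇒X≡0 {a = suc _} (_     , ()   , _)

  splitCount-zero : ∀ X → SplitCountSpec 0 X
  splitCount-zero X = admissible , inadmissible
    where
    admissible : Admissible 0 X → splitCount 0 X ≡ 2 ^ g X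
    admissible adm with refl ← Equivalence.to admissible-zero⇔ adm = refl
    inadmissible : ¬ Admissible 0 X → splitCount 0 X ≡ 0
    inadmissible ¬adm = count-≡0 (splits? 0 X) 1 λ _ _ sp → ¬adm (Equivalence.from admissible-zero⇔ (splits-0⇒X≡0 sp))

  splitCount-odd-step : ∀ {S X} → SplitCountSpec S X → SplitCountSpec (1 + S * 2) (1 + X * 2)
  splitCount-odd-step {S} {X} (admissible , inadmissible) =
    (λ adm → let adm′ = Equivalence.to admissible-odd⇔ adm in
       trans halves (trans (cong₂ _+_ (admissible adm′) (admissible adm′)) (sym 2^g≡))) ,
    (λ ¬adm → let ¬adm′ = ¬adm ∘ Equivalence.from admissible-odd⇔ in
       trans halves (cong₂ _+_ (inadmissible ¬adm′) (inadmissible ¬adm′)))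
    where
    halves : splitCount (1 + S * 2) (1 + X * 2) ≡ splitCount S X + splitCount S X
    halves = trans (splitCount-even-odd S (1 + X * 2) 1<2)
                   (cong₂ _+_ (count-cong (λ a → splits? (1 + S * 2) (1 + X * 2) (a * 2)) (splits? S X) (suc S)
                                          λ _ _ → splits-even⇔ 1<2)
                              (count-cong (λ a → splits? (1 + S * 2) (1 + X * 2) (1 + a * 2)) (splits? S X) (suc S)
                                          λ _ _ → splits-odd⇔))
    2^g≡ : 2 ^ g (1 + X * 2) ≡ 2 ^ g X + 2 ^ g X
    2^g≡ = trans (cong (2 ^_) (g-step X 1<2)) (cong (2 ^ g X +_) (+-identityʳ (2 ^ g X)))

  splitCount-even-step : ∀ {S X} → SplitCountSpec (suc S) X → SplitCountSpec S X → SplitCountSpec (suc S * 2) (X * 2)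
  splitCount-even-step {S} {X} (admissible₁ , inadmissible₁) (admissible₀ , inadmissible₀) =
    (λ adm → trans halves (trans (both-admissible (Equivalence.to admissible-even⇔ adm)) 2^g≡)) ,
    (λ ¬adm → trans halves (cong₂ _+_ (inadmissible₁ (¬adm ∘ Equivalence.from admissible-even⇔ ∘ inj₁))
                                      (inadmissible₀ (¬adm ∘ Equivalence.from admissible-even⇔ ∘ inj₂))))
    where
    open ≡-Reasoning
    halves : splitCount (suc S * 2) (X * 2) ≡ splitCount (suc S) X + splitCount S X
    halves = trans (splitCount-even-odd (suc S) (X * 2) 0<2)
                   (cong₂ _+_ (count-cong (λ a → splits? (suc S * 2) (X * 2) (a * 2)) (splits? (suc S) X) (suc (suc S))
                                          λ _ _ → splits-even⇔ 0<2)
                              (trans (count-cong (λ a → splits? (suc S * 2) (X * 2) (1 + a * 2)) (splits? S X) (suc (suc S))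
                                                 λ _ _ → splits-carry⇔)
                                     (count-bounded (splits? S X) (λ _ → s≤s ∘ splits-≤) (n≤1+n (suc S)))))
    2^g≡ : 2 ^ g X ≡ 2 ^ g (X * 2)
    2^g≡ = cong (2 ^_) (sym (g-step X 0<2))
    both-admissible : Admissible (suc S) X ⊎ Admissible S X → splitCount (suc S) X + splitCount S X ≡ 2 ^ g X
    both-admissible (inj₁ adm) = begin
      splitCount (suc S) X + splitCount S X ≡⟨ cong₂ _+_ (admissible₁ adm) (inadmissible₀ (admissible-suc-exclusive adm)) ⟩
      2 ^ g X + 0                           ≡⟨ +-identityʳ _ ⟩
      2 ^ g X                               ∎
    both-admissible (inj₂ adm) = cong₂ _+_ (inadmissible₁ (λ adm₁ → admissible-suc-exclusive adm₁ adm)) (admissible₀ adm)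

  splitCount-spec : ∀ S X → SplitCountSpec S X
  splitCount-spec = <-rec (λ S → ∀ X → SplitCountSpec S X) step
    where
    step : ∀ S → (∀ {m} → m < S → ∀ X → SplitCountSpec m X) → ∀ X → SplitCountSpec S X
    step S rec X with evenOdd S | evenOdd X
    ... | even zero     | even X′ = splitCount-zero (X′ * 2)
    ... | even (suc S′) | even X′ =
      splitCount-even-step (rec (s<s (s≤s (m≤m*n S′ 2))) X′) (rec (s≤s (m≤n⇒m≤1+n (m≤m*n S′ 2))) X′)
    ... | odd S′        | odd X′  = splitCount-odd-step (rec (s≤s (m≤m*n S′ 2)) X′)
    ... | even S′       | odd X′  = splitCount-parity-mismatch ([k*2]%2≢[1+m*2]%2 S′ X′)
    ... | odd S′        | even X′ = splitCount-parity-mismatch ([k*2]%2≢[1+m*2]%2 X′ S′ ∘ sym)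

module Pairs where

  open import Defs
  open FiniteSums
  open BinaryDigits
  open Splittings
  open import Data.Nat.Base
  open import Data.Nat.Properties
  open import Data.Nat.ListAction using (sum)
  open import Data.List.Base using (map; upTo; cartesianProduct)
  open import Data.Product using (_×_; _,_; proj₁; proj₂)
  open import Data.Sum using (_⊎_; inj₁; inj₂)
  open import Data.Unit using (tt)
  open import Function using (_∘_)
  open import Function.Bundles using (_⇔_; mk⇔; Equivalence)
  open import Relation.Binary.PropositionalEquality using (_≡_; _≢_; refl; sym; trans; cong; subst; module ≡-Reasoning)
  open import Relation.Binary.Definitions using (tri<; tri≈; tri>)
  open import Relation.Nullary using (Dec; yes; ¬_; contradiction)
  open import Relation.Nullary.Decidable using (_×-dec_)
  open import Data.Nat.Tactic.RingSolver using (solve-∀)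

  Pair : ℕ → ℕ → ℕ → Set
  Pair S X a = 1 ≤ a × a ≤ S ∸ a × Splits S X a

  pair? : ∀ S X a → Dec (Pair S X a)
  pair? S X a = (1 ≤? a) ×-dec (a ≤? S ∸ a) ×-dec splits? S X a

  countPairs≡count-pair : ∀ S X → countPairs S X ≡ count (pair? S X) (suc S)
  countPairs≡count-pair S X = begin
    countPairs S X                                      ≡⟨ length-filter (isPair? S X) (cartesianProduct U U) ⟩
    sum (map (χ ∘ isPair? S X) (cartesianProduct U U))  ≡⟨ sum-map-cartesianProduct (χ ∘ isPair? S X) U U ⟩
    sum (map (λ a → sum (map (row a) U)) U)             ≡⟨ sum-map-upTo (λ a → sum (map (row a) U)) (suc S) ⟩
    ∑< (suc S) (λ a → sum (map (row a) U))              ≡⟨ ∑<-cong (suc S) (λ a _ → trans (sum-map-upTo (row a) (suc S)) (partner-unique a)) ⟩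
    count (pair? S X) (suc S)                           ∎
    where
    open ≡-Reasoning
    U = upTo (suc S)
    row : ℕ → ℕ → ℕ
    row a b = χ (isPair? S X (a , b))
    partner-unique : ∀ a → count (λ b → isPair? S X (a , b)) (suc S) ≡ χ (pair? S X a)
    partner-unique a = count-unique (λ b → isPair? S X (a , b)) (pair? S X a) (s≤s (m∸n≤m S a))
      (λ { b (_ , _ , refl , _) → sym (m+n∸m≡n a b) })
      (mk⇔ (λ (1≤a , a≤b , sum≡ , xor≡0) → 1≤a , a≤b , S ∸ a , sum≡ , ⊕≡0⇒≡ _ X xor≡0)
           (λ (1≤a , a≤b , sp) → let (a≤S , xor≡) = Equivalence.to splits⇔ sp in
              1≤a , a≤b , m+[n∸m]≡n a≤S , subst (λ y → y ⊕ X ≡ 0) (sym xor≡) (⊕-self X)))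

  splits-mirror : ∀ {S X a} → Splits S X a → Splits S X (S ∸ a)
  splits-mirror {a = a} (b , refl , refl) =
    a , trans (cong (_+ a) (m+n∸m≡n a b)) (+-comm b a) , trans (cong (_⊕ a) (m+n∸m≡n a b)) (⊕-comm b a)

  splits-diagonal : ∀ {S X a} → Splits S X a → a ≡ S ∸ a → X ≡ 0
  splits-diagonal {S} {X} {a} sp a≡S∸a =
    trans (sym (proj₂ (Equivalence.to splits⇔ sp))) (trans (cong (a ⊕_) (sym a≡S∸a)) (⊕-self a))

  Lower : ℕ → ℕ → ℕ → Set
  Lower S X a = Splits S X a × a < S ∸ a

  lower? : ∀ S X a → Dec (Lower S X a)
  lower? S X a = splits? S X a ×-dec (a <? S ∸ a)

  Upper : ℕ → ℕ → ℕ → Set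
  Upper S X a = Splits S X a × S ∸ a < a

  upper? : ∀ S X a → Dec (Upper S X a)
  upper? S X a = splits? S X a ×-dec (S ∸ a <? a)

  upper-mirror⇔ : ∀ {S X a} → a ≤ S → Upper S X (S ∸ a) ⇔ Lower S X a
  upper-mirror⇔ {S} {X} {a} a≤S = mk⇔
    (λ (sp , lt) → subst (Splits S X) S∸[S∸a]≡a (splits-mirror sp) , subst (_< S ∸ a) S∸[S∸a]≡a lt)
    (λ (sp , lt) → splits-mirror sp , subst (_< S ∸ a) (sym S∸[S∸a]≡a) lt)
    where
    S∸[S∸a]≡a : S ∸ (S ∸ a) ≡ a
    S∸[S∸a]≡a = m∸[m∸n]≡n a≤S

  lowerCount : ℕ → ℕ → ℕ
  lowerCount S X = count (lower? S X) (suc S)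

  splitCount≡lowerCount+lowerCount : ∀ S {X} → X ≢ 0 → splitCount S X ≡ lowerCount S X + lowerCount S X
  splitCount≡lowerCount+lowerCount S {X} X≢0 = begin
    splitCount S X                                       ≡⟨ ∑<-cong (suc S) (λ a _ → lower-or-upper a) ⟩
    ∑< (suc S) (λ a → χ (lower? S X a) + χ (upper? S X a)) ≡⟨ ∑<-+ (suc S) (χ ∘ lower? S X) (χ ∘ upper? S X) ⟩
    lowerCount S X + count (upper? S X) (suc S)          ≡⟨ cong (lowerCount S X +_) upper≡lower ⟩
    lowerCount S X + lowerCount S X                      ∎
    where
    open ≡-Reasoning
    lower-or-upper : ∀ a → χ (splits? S X a) ≡ χ (lower? S X a) + χ (upper? S X a)
    lower-or-upper a = χ-⊎ (splits? S X a) (lower? S X a) (upper? S X a) trichotomy proj₁ proj₁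
                           (λ (_ , lt) (_ , gt) → <-asym lt gt)
      where
      trichotomy : Splits S X a → Lower S X a ⊎ Upper S X a
      trichotomy sp with <-cmp a (S ∸ a)
      ... | tri< lt _ _ = inj₁ (sp , lt)
      ... | tri≈ _ eq _ = contradiction (splits-diagonal sp eq) X≢0
      ... | tri> _ _ gt = inj₂ (sp , gt)
    upper≡lower : count (upper? S X) (suc S) ≡ lowerCount S X
    upper≡lower = trans (∑<-reverse (suc S) (χ ∘ upper? S X))
                        (count-cong (λ a → upper? S X (S ∸ a)) (lower? S X) (suc S) λ a a≤S → upper-mirror⇔ (≤-pred a≤S))

  lowerCount≡lower-0+pairs : ∀ S {X} → X ≢ 0 → lowerCount S X ≡ χ (lower? S X 0) + count (pair? S X) (suc S)
  lowerCount≡lower-0+pairs S {X} X≢0 =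
    cong (χ (lower? S X 0) +_)
         (count-cong (lower? S X ∘ suc) (pair? S X ∘ suc) S λ a _ → mk⇔
           (λ (sp , lt) → s≤s z≤n , <⇒≤ lt , sp)
           (λ (_ , le , sp) → sp , ≤∧≢⇒< le (X≢0 ∘ splits-diagonal sp)))

  m+m≡n+n⇒m≡n : ∀ {m n} → m + m ≡ n + n → m ≡ n
  m+m≡n+n⇒m≡n {m} {n} eq = *-cancelʳ-≡ m n 2 (trans (doubling m) (trans eq (sym (doubling n))))
    where
    doubling : ∀ m → m * 2 ≡ m + m
    doubling = solve-∀

  2^n≡2^[n∸1]+2^[n∸1] : ∀ {n} → 0 < n → 2 ^ n ≡ 2 ^ (n ∸ 1) + 2 ^ (n ∸ 1)
  2^n≡2^[n∸1]+2^[n∸1] {suc n} _ = cong (2 ^ n +_) (+-identityʳ (2 ^ n))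

  lowerCount-admissible : ∀ {S X} → X ≢ 0 → Admissible S X → lowerCount S X ≡ 2 ^ (g X ∸ 1)
  lowerCount-admissible {S} {X} X≢0 adm = m+m≡n+n⇒m≡n (begin
    lowerCount S X + lowerCount S X     ≡⟨ splitCount≡lowerCount+lowerCount S X≢0 ⟨
    splitCount S X                      ≡⟨ proj₁ (splitCount-spec S X) adm ⟩
    2 ^ g X                             ≡⟨ 2^n≡2^[n∸1]+2^[n∸1] (g-pos X (n≢0⇒n>0 X≢0)) ⟩
    2 ^ (g X ∸ 1) + 2 ^ (g X ∸ 1)       ∎)
    where open ≡-Reasoning

  countPairs-inadmissible : ∀ {S X} → ¬ Admissible S X → countPairs S X ≡ 0
  countPairs-inadmissible {S} {X} ¬adm = n≤0⇒n≡0 (begin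
    countPairs S X               ≡⟨ countPairs≡count-pair S X ⟩
    count (pair? S X) (suc S)    ≤⟨ count-mono (pair? S X) (splits? S X) (suc S) (λ _ _ → proj₂ ∘ proj₂) ⟩
    splitCount S X               ≡⟨ proj₂ (splitCount-spec S X) ¬adm ⟩
    0                            ∎)
    where open ≤-Reasoning

  0-splits⇒S≡X : ∀ {S X} → Splits S X 0 → S ≡ X
  0-splits⇒S≡X (b , refl , refl) = sym (⊕-identityˡ b)

  countPairs-diagonal : ∀ {X} → Admissible X X → countPairs X X ≡ 2 ^ (g X ∸ 1) ∸ 1
  countPairs-diagonal {zero}      _   = refl
  countPairs-diagonal {X@(suc _)} adm = begin
    countPairs X X                                   ≡⟨ countPairs≡count-pair X X ⟩
    count (pair? X X) (suc X)                        ≡⟨ m+n∸m≡n 1 _ ⟨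
    1 + count (pair? X X) (suc X) ∸ 1
      ≡⟨ cong (λ n → n + count (pair? X X) (suc X) ∸ 1) (χ-yes (lower? X X 0) zero-is-lower) ⟨
    χ (lower? X X 0) + count (pair? X X) (suc X) ∸ 1 ≡⟨ cong (_∸ 1) (lowerCount≡lower-0+pairs X X≢0) ⟨
    lowerCount X X ∸ 1                               ≡⟨ cong (_∸ 1) (lowerCount-admissible X≢0 adm) ⟩
    2 ^ (g X ∸ 1) ∸ 1                                ∎
    where
    open ≡-Reasoning
    X≢0 : X ≢ 0
    X≢0 ()
    zero-is-lower : Lower X X 0
    zero-is-lower = (X , refl , ⊕-identityˡ X) , z<s

  countPairs-zero-xor : ∀ {S} → S ≢ 0 → Admissible S 0 → countPairs S 0 ≡ 1
  countPairs-zero-xor {S} S≢0 (d , S≡d*2 , _) = trans (countPairs≡count-pair S 0)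
    (count-unique (pair? S 0) (yes tt) (s≤s d≤S) unique (mk⇔ (λ _ → tt) (λ _ → d-is-pair)))
    where
    doubling : ∀ m → m * 2 ≡ m + m
    doubling = solve-∀
    d≤S : d ≤ S
    d≤S = subst (d ≤_) (sym S≡d*2) (m≤m*n d 2)
    S∸d≡d : S ∸ d ≡ d
    S∸d≡d = trans (cong (_∸ d) (trans S≡d*2 (doubling d))) (m+n∸m≡n d d)
    unique : ∀ b → Pair S 0 b → b ≡ d
    unique b (_ , _ , b′ , b+b′≡S , b⊕b′≡0) with refl ← ⊕≡0⇒≡ b b′ b⊕b′≡0 =
      *-cancelʳ-≡ b d 2 (trans (doubling b) (trans b+b′≡S S≡d*2))
    d-is-pair : Pair S 0 d
    d-is-pair = n≢0⇒n>0 (λ { refl → S≢0 S≡d*2 }) , ≤-reflexive (sym S∸d≡d) ,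
                Equivalence.from splits⇔ (d≤S , subst (λ y → d ⊕ y ≡ 0) (sym S∸d≡d) (⊕-self d))

  countPairs-off-diagonal : ∀ {S X} → S ≢ X → Admissible S X → countPairs S X ≡ 2 ^ (g X ∸ 1)
  countPairs-off-diagonal {S} {zero}      S≢X adm = countPairs-zero-xor S≢X adm
  countPairs-off-diagonal {S} {X@(suc _)} S≢X adm = begin
    countPairs S X                                   ≡⟨ countPairs≡count-pair S X ⟩
    count (pair? S X) (suc S)
      ≡⟨ cong (_+ count (pair? S X) (suc S)) (χ-no (lower? S X 0) (S≢X ∘ 0-splits⇒S≡X ∘ proj₁)) ⟨
    χ (lower? S X 0) + count (pair? S X) (suc S)     ≡⟨ lowerCount≡lower-0+pairs S X≢0 ⟨
    lowerCount S X                                   ≡⟨ lowerCount-admissible X≢0 adm ⟩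
    2 ^ (g X ∸ 1)                                    ∎
    where
    open ≡-Reasoning
    X≢0 : X ≢ 0
    X≢0 ()

module IntegerDifference where

  open import Defs
  open BinaryDigits
  open Splittings
  open import Data.Nat.Base
  open import Data.Nat.Properties
  open import Data.Product using (∃; _×_; _,_)
  open import Function using (_∘_)
  open import Relation.Binary.PropositionalEquality using (_≡_; refl; sym; trans; cong; subst)
  open import Relation.Nullary using (¬_; yes; no; contradiction)
  import Data.Integer as ℤ
  open ℤ using (ℤ; +_; -[1+_])
  import Data.Integer.Properties as ℤᴾ

  [+m]-[+n]≡+⇒ : ∀ {m n k} → + m ℤ.- + n ≡ + k → m ≡ n + k
  [+m]-[+n]≡+⇒ {m} {n} eq with n ≤? m | trans (sym (ℤᴾ.[+m]-[+n]≡m⊖n m n)) eq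
  ... | yes n≤m | m⊖n≡k = trans (sym (m+[n∸m]≡n n≤m)) (cong (_+_ n) (ℤᴾ.+-injective (trans (sym (ℤᴾ.⊖-≥ n≤m)) m⊖n≡k)))
  ... | no n≰m  | m⊖n≡k with n ∸ m | m>n⇒m∸n≢0 (≰⇒> n≰m) | ℤᴾ.⊖-≰ n≰m
  ...   | zero  | n∸m≢0 | _     = contradiction refl n∸m≢0
  ...   | suc _ | _     | m⊖n≡ with () ← trans (sym m⊖n≡) m⊖n≡k

  [+m]-[+n]≡-[1+]⇒ : ∀ {m n k} → + m ℤ.- + n ≡ -[1+ k ] → n ≡ m + suc k
  [+m]-[+n]≡-[1+]⇒ {m} {n} eq with n ≤? m | trans (sym (ℤᴾ.[+m]-[+n]≡m⊖n m n)) eq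
  ... | yes n≤m | m⊖n≡ with () ← trans (sym (ℤᴾ.⊖-≥ n≤m)) m⊖n≡
  ... | no n≰m  | m⊖n≡ = trans (sym (m+[n∸m]≡n (<⇒≤ (≰⇒> n≰m)))) (cong (_+_ m) (negated (trans (sym (ℤᴾ.⊖-≰ n≰m)) m⊖n≡)))
    where
    negated : ∀ {j k} → ℤ.- + j ≡ -[1+ k ] → j ≡ suc k
    negated {suc j} eq = cong suc (ℤᴾ.-[1+-injective eq)

  ≡⇒[+m]-[+n]≡+ : ∀ {m n k} → m ≡ n + k → + m ℤ.- + n ≡ + k
  ≡⇒[+m]-[+n]≡+ {n = n} {k} refl =
    trans (ℤᴾ.[+m]-[+n]≡m⊖n (n + k) n) (trans (ℤᴾ.⊖-≥ (m≤m+n n k)) (cong +_ (m+n∸m≡n n k)))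

  +2*+d≡+[d*2] : ∀ d → + 2 ℤ.* + d ≡ + (d * 2)
  +2*+d≡+[d*2] d = trans (sym (ℤᴾ.pos-* 2 d)) (cong +_ (*-comm 2 d))

  admissible⇒even-difference : ∀ {S X} → Admissible S X → ∃ λ d → + S ℤ.- + X ≡ + 2 ℤ.* d
  admissible⇒even-difference (d , S≡X+d*2 , _) = + d , trans (≡⇒[+m]-[+n]≡+ S≡X+d*2) (sym (+2*+d≡+[d*2] d))

  overlap⇒inadmissible : ∀ {S X d} → + S ℤ.- + X ≡ + 2 ℤ.* d →
                         (∃ λ i → bitℤ d i ≡ 1 × bit X i ≡ 1) → ¬ Admissible S X
  overlap⇒inadmissible {d = d} diff≡ (i , bd , bX) (d′ , S≡X+d′*2 , disjoint) =
    disjoint (i , subst (λ z → bitℤ z i ≡ 1) d≡+d′ bd , bX)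
    where
    d≡+d′ : d ≡ + d′
    d≡+d′ = ℤᴾ.*-cancelˡ-≡ (+ 2) d (+ d′)
              (trans (sym diff≡) (trans (≡⇒[+m]-[+n]≡+ S≡X+d′*2) (sym (+2*+d≡+[d*2] d′))))

  disjoint⇒admissible : ∀ {S X d} → + S ℤ.- + X ≡ + 2 ℤ.* d →
                        ¬ (∃ λ i → bitℤ d i ≡ 1 × bit X i ≡ 1) → Admissible S X
  disjoint⇒admissible {d = + d} diff≡ disjoint = d , [+m]-[+n]≡+⇒ (trans diff≡ (+2*+d≡+[d*2] d)) , disjoint
  disjoint⇒admissible {S} {X} { -[1+ n ]} diff≡ disjoint = contradiction (bits-⊆⇒≤ X n X⊆n) (<⇒≱ n<X)
    where
    n<X : n < X
    n<X = subst (n <_) (sym ([+m]-[+n]≡-[1+]⇒ diff≡)) (≤-trans (s≤s (m≤m+n n _)) (m≤n+m _ S))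
    X⊆n : ∀ i → bit X i ≡ 1 → bit n i ≡ 1
    X⊆n i bX with bit n i | bit<2 n i | disjoint ∘ (i ,_) ∘ (_, bX)
    ... | 0 | _                 | ¬complement = contradiction refl ¬complement
    ... | 1 | _                 | _          = refl
    ... | suc (suc _) | s<s (s<s ()) | _

open import Defs
open import Data.Nat using (ℕ; _∸_; _^_)
open import Data.Integer using (ℤ; +_; _-_; _*_)
open import Data.Product using (_×_; ∃; _,_)
open import Relation.Binary.PropositionalEquality using (_≡_; refl)
open import Relation.Nullary using (¬_)
open import Function using (_∘_)
open Pairs using (countPairs-inadmissible; countPairs-diagonal; countPairs-off-diagonal)
open IntegerDifference using (admissible⇒even-difference; overlap⇒inadmissible; disjoint⇒admissible)

lemma7p3 : (S X : ℕ) →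
    -- case 1: S - X odd
    ((¬ ∃ λ d → + S - + X ≡ + 2 * d) → countPairs S X ≡ 0)
    -- case 2: S - X = 2d and some binary digit of d and of X are both 1
    × ((d : ℤ) → + S - + X ≡ + 2 * d →
         (∃ λ i → (bitℤ d i ≡ 1) × (bit X i ≡ 1)) → countPairs S X ≡ 0)
    -- case 3: otherwise, S = X
    × ((d : ℤ) → + S - + X ≡ + 2 * d →
         (¬ ∃ λ i → (bitℤ d i ≡ 1) × (bit X i ≡ 1)) →
         S ≡ X → countPairs S X ≡ 2 ^ (g X ∸ 1) ∸ 1)
    -- case 4: otherwise
    × ((d : ℤ) → + S - + X ≡ + 2 * d →
         (¬ ∃ λ i → (bitℤ d i ≡ 1) × (bit X i ≡ 1)) →
         ¬ S ≡ X → countPairs S X ≡ 2 ^ (g X ∸ 1))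
lemma7p3 S X =
    (λ ¬even → countPairs-inadmissible {S} {X} (¬even ∘ admissible⇒even-difference))
  , (λ d diff≡ common-bit → countPairs-inadmissible {S} {X} (overlap⇒inadmissible diff≡ common-bit))
  , (λ { d diff≡ disjoint refl → countPairs-diagonal (disjoint⇒admissible diff≡ disjoint) })
  , (λ d diff≡ disjoint S≢X → countPairs-off-diagonal S≢X (disjoint⇒admissible diff≡ disjoint))
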